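{- For $n\ge0$ let $C_n(a,r)=\sum_{m=0}^{n}\binom{n}{m}(a)_m r^{n-m}$, where $(u)_m=u(u+1)\cdots(u+m-1)$. Then, as formal power series in $x,y,z$ (with $a,b,r,s$ indeterminates), \[ \sum_{l,m,n\ge0} C_{l+m}(a,r)\, C_{l+n}(b,s)\, \frac{x^l}{l!}\frac{y^m}{m!}\frac{z^n}{n!} = e^{rsx+ry+sz}\sum_{l\ge0}\frac{(a)_{l}\,(b)_{l}}{(1-sx-y)^{l+a}\,(1-rx-z)^{l+b}}\,\frac{x^l}{l!}. \]
   Context: $(1-w)^{ -e}$ for an indeterminate exponent $e$ and a power series $w$ without constant term denotes the formal binomial series $\sum_{m\ge0}(e)_m w^m/m!$. -}

module Defs where

open import Level using (Level)
open import Data.Nat as ℕ using (ℕ; zero; suc; _∸_)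
open import Data.Nat.Combinatorics using (_C_)
open import Algebra.Bundles using (CommutativeRing)
import Relation.Nullary

-- All constructions are carried out over an arbitrary commutative ring R
-- in which the positive integers are invertible (a ℚ-algebra).  The paper's
-- indeterminates a,b,r,s become arbitrary elements of R (taking R = ℚ[a,b,r,s]
-- recovers the paper's setting).
module Series {c ℓ : Level} (R : CommutativeRing c ℓ) where
  open CommutativeRing R

  cast : ℕ → Carrier
  cast zero    = 0#
  cast (suc n) = 1# + cast n

  pow : Carrier → ℕ → Carrier
  pow u zero    = 1#
  pow u (suc n) = u * pow u n

  sumUpTo : ℕ → (ℕ → Carrier) → Carrier
  sumUpTo zero    f = f 0
  sumUpTo (suc n) f = sumUpTo n f + f (suc n)

  poch : Carrier → ℕ → Carrier
  poch u zero    = 1#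
  poch u (suc m) = poch u m * (u + cast m)

  Cpoly : ℕ → Carrier → Carrier → Carrier
  Cpoly n a r = sumUpTo n (λ m → cast (n C m) * poch a m * pow r (n ∸ m))

  module WithInverses (inv : ℕ → Carrier) where
    -- inv k is meant to be the inverse of (k+1) in R

    invFact : ℕ → Carrier
    invFact zero    = 1#
    invFact (suc k) = invFact k * inv k

    -- formal power series in x, y, z : coefficient of x^i y^j z^k
    PS3 : Set c
    PS3 = ℕ → ℕ → ℕ → Carrier

    _⊛_ : PS3 → PS3 → PS3
    (f ⊛ g) i j k =
      sumUpTo i λ i₁ → sumUpTo j λ j₁ → sumUpTo k λ k₁ →
        f i₁ j₁ k₁ * g (i ∸ i₁) (j ∸ j₁) (k ∸ k₁)

    one : PS3
    one zero zero zero = 1#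
    one _    _    _    = 0#

    powPS : PS3 → ℕ → PS3
    powPS f zero    = one
    powPS f (suc m) = f ⊛ powPS f m

    lin : Carrier → Carrier → Carrier → PS3
    lin α β γ 1 0 0 = α
    lin α β γ 0 1 0 = β
    lin α β γ 0 0 1 = γ
    lin α β γ _ _ _ = 0#

    -- Σ_{m≥0} c_m w^m for a series w WITHOUT constant term (used only for
    -- such w here): since w^m has no terms of total degree < m, the
    -- coefficient of x^i y^j z^k only receives contributions from m ≤ i+j+k.
    compose : (ℕ → Carrier) → PS3 → PS3
    compose cf w i j k =
      sumUpTo (i ℕ.+ j ℕ.+ k) λ m → cf m * powPS w m i j k

    expPS : PS3 → PS3
    expPS w = compose invFact w

    -- (1 - w)^{-e} = Σ_{m≥0} (e)_m w^m / m!
    binomPS : Carrier → PS3 → PS3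
    binomPS e w = compose (λ m → poch e m * invFact m) w

    xmono : ℕ → Carrier → PS3
    xmono l cst i zero zero with i ℕ.≟ l
    ... | Relation.Nullary.yes _ = cst
    ... | Relation.Nullary.no  _ = 0#
    xmono l cst _ _ _ = 0#

    rhsTerm : Carrier → Carrier → Carrier → Carrier → ℕ → PS3
    rhsTerm a b r s l =
      (binomPS (cast l + a) (lin s 1# 0#) ⊛ binomPS (cast l + b) (lin r 0# 1#))
        ⊛ xmono l (poch a l * poch b l * invFact l)

    -- Σ_{l≥0} rhsTerm l : the l-th term is divisible by x^l, so the
    -- coefficient of x^i y^j z^k only receives contributions from l ≤ i.
    rhsSum : Carrier → Carrier → Carrier → Carrier → PS3
    rhsSum a b r s i j k = sumUpTo i λ l → rhsTerm a b r s l i j k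

    RHS : Carrier → Carrier → Carrier → Carrier → PS3
    RHS a b r s = expPS (lin (r * s) r s) ⊛ rhsSum a b r s

    LHS : Carrier → Carrier → Carrier → Carrier → PS3
    LHS a b r s l m n =
      Cpoly (l ℕ.+ m) a r * Cpoly (l ℕ.+ n) b s
        * (invFact l * invFact m * invFact n)

module Submission where

-- The identity is proved coefficientwise, over any commutative ring in which the
-- positive integers are invertible: both sides have coefficient Outer L W / (L! M! N!)
-- at x^L y^M z^N, for an explicit nested binomial sum Outer L W.
--
-- On doubly indexed families
-- let E₁, E₂ be the two shifts.  Then C_n(a,r) C_n′(b,s) is the (0,0)-entry of
-- (r+E₁)^n (s+E₂)^n′ applied to (u,w) ↦ (a)_u (b)_w.  Since the operators commute,
-- (r+E₁)^(L+M) (s+E₂)^(L+N) = T^L (r+E₁)^M (s+E₂)^N with T = rs + E₁E₂ + sE₁ + rE₂,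
-- and the binomial theorem for commuting additive operators, applied three times,
-- expands T^L into Outer L W, where W is the family produced by (r+E₁)^M (s+E₂)^N.
--
-- The multinomial theorem gives explicit
-- coefficients of e^(rsx+ry+sz) and of the binomial series (1-w)^(-e); the Cauchy
-- products then become finite sums which collapse one summation at a time, using
-- (a)_l (l+a)_m = (a)_(l+m) and 1/(i! (n-i)!) = binom(n,i)/n!, to the same value.

open import Defs
open import Level using (Level; _⊔_)
open import Data.Nat as ℕ using (ℕ; zero; suc; _∸_; _≤_; z≤n; s≤s; _!)
import Data.Nat.Properties as ℕₚ
open import Data.Nat.Properties using (_!*_!≢0)
open import Data.Nat.Combinatorics using (_C_; k>n⇒nCk≡0; nCk+nC[k+1]≡[n+1]C[k+1]; nCk≡n!/k![n-k]!; k![n∸k]!∣n!)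
open import Data.Nat.DivMod using (m/n*n≡m)
open import Data.Nat.Tactic.RingSolver using (solve-∀)
open import Algebra.Bundles using (CommutativeRing)
open import Relation.Binary.PropositionalEquality as P using (_≡_; _≢_)
open import Relation.Nullary using (yes; no; ¬_)
open import Data.Empty using (⊥-elim)
open import Data.Product using (_×_; _,_; proj₁; proj₂)
open import Data.Maybe using (nothing)

module RingFacts {c ℓ : Level} (R : CommutativeRing c ℓ) where
  open CommutativeRing R hiding (zero)
  open Series R
  open import Relation.Binary.Reasoning.Setoid setoid
  open import Algebra.Solver.Ring.NaturalCoefficients commutativeSemiring (λ _ _ → nothing)
    using (solve; _:=_; _:+_; _:*_)
  open import Algebra.Properties.CommutativeSemigroup *-commutativeSemigroup
    using (x∙yz≈y∙xz; x∙yz≈yx∙z)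
  open import Algebra.Properties.CommutativeSemigroup +-commutativeSemigroup
    using () renaming (interchange to +-interchange; x∙yz≈y∙xz to x+[y+z]≈y+[x+z])

  ≡⇒≈ : ∀ {x y} → x ≡ y → x ≈ y
  ≡⇒≈ P.refl = refl

  ∑ : ℕ → (ℕ → Carrier) → Carrier
  ∑ = sumUpTo

  ∑-cong≤ : ∀ n {f g : ℕ → Carrier} → (∀ i → i ≤ n → f i ≈ g i) → ∑ n f ≈ ∑ n g
  ∑-cong≤ zero    f≈g = f≈g 0 z≤n
  ∑-cong≤ (suc n) f≈g =
    +-cong (∑-cong≤ n (λ i i≤n → f≈g i (ℕₚ.m≤n⇒m≤1+n i≤n))) (f≈g (suc n) ℕₚ.≤-refl)

  ∑-cong : ∀ n {f g : ℕ → Carrier} → (∀ i → f i ≈ g i) → ∑ n f ≈ ∑ n g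
  ∑-cong n f≈g = ∑-cong≤ n (λ i _ → f≈g i)

  ∑-+ : ∀ n (f g : ℕ → Carrier) → ∑ n (λ i → f i + g i) ≈ ∑ n f + ∑ n g
  ∑-+ zero    f g = refl
  ∑-+ (suc n) f g = trans (+-congʳ (∑-+ n f g)) (+-interchange _ _ _ _)

  ∑-*ˡ : ∀ n x (f : ℕ → Carrier) → x * ∑ n f ≈ ∑ n (λ i → x * f i)
  ∑-*ˡ zero    x f = refl
  ∑-*ˡ (suc n) x f = trans (distribˡ x _ _) (+-congʳ (∑-*ˡ n x f))

  ∑-*ʳ : ∀ n x (f : ℕ → Carrier) → ∑ n f * x ≈ ∑ n (λ i → f i * x)
  ∑-*ʳ zero    x f = refl
  ∑-*ʳ (suc n) x f = trans (distribʳ x _ _) (+-congʳ (∑-*ʳ n x f))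

  ∑∑-product : ∀ n m (f g : ℕ → Carrier) →
    ∑ n (λ i → ∑ m (λ j → f i * g j)) ≈ ∑ n f * ∑ m g
  ∑∑-product n m f g =
    trans (∑-cong n (λ i → sym (∑-*ˡ m (f i) g))) (sym (∑-*ʳ n (∑ m g) f))

  ∑-zero : ∀ n {f : ℕ → Carrier} → (∀ i → i ≤ n → f i ≈ 0#) → ∑ n f ≈ 0#
  ∑-zero n f≈0 = trans (∑-cong≤ n f≈0) (∑-const0 n)
    where
    ∑-const0 : ∀ n → ∑ n (λ _ → 0#) ≈ 0#
    ∑-const0 zero    = refl
    ∑-const0 (suc n) = trans (+-congʳ (∑-const0 n)) (+-identityˡ 0#)

  ∑-single : ∀ n t {f : ℕ → Carrier} → t ≤ n → (∀ i → i ≤ n → i ≢ t → f i ≈ 0#) →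
    ∑ n f ≈ f t
  ∑-single zero .zero z≤n _ = refl
  ∑-single (suc n) t {f} t≤1+n off with t ℕ.≟ suc n
  ... | yes P.refl =
    trans (+-congʳ (∑-zero n (λ i i≤n → off i (ℕₚ.m≤n⇒m≤1+n i≤n) (λ i≡ → ℕₚ.<-irrefl i≡ (s≤s i≤n)))))
          (+-identityˡ _)
  ... | no t≢1+n =
    trans (+-cong (∑-single n t (ℕₚ.≤-pred (ℕₚ.≤∧≢⇒< t≤1+n t≢1+n))
                                (λ i i≤n → off i (ℕₚ.m≤n⇒m≤1+n i≤n)))
                  (off (suc n) ℕₚ.≤-refl (λ e → t≢1+n (P.sym e))))
          (+-identityʳ _)

  ∑-swap : ∀ n m (f : ℕ → ℕ → Carrier) →
    ∑ n (λ i → ∑ m (λ j → f i j)) ≈ ∑ m (λ j → ∑ n (λ i → f i j))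
  ∑-swap zero    m f = refl
  ∑-swap (suc n) m f = trans (+-congʳ (∑-swap n m f)) (sym (∑-+ m _ _))

  ∑-rotate : ∀ n m k (f : ℕ → ℕ → ℕ → Carrier) →
    ∑ n (λ i → ∑ m (λ j → ∑ k (λ l → f i j l))) ≈ ∑ k (λ l → ∑ n (λ i → ∑ m (λ j → f i j l)))
  ∑-rotate n m k f = trans (∑-cong n (λ i → ∑-swap m k _)) (∑-swap n k _)

  ∑-peel : ∀ n (f : ℕ → Carrier) → ∑ (suc n) f ≈ f 0 + ∑ n (λ i → f (suc i))
  ∑-peel zero    f = refl
  ∑-peel (suc n) f = trans (+-congʳ (∑-peel n f)) (+-assoc _ _ _)

  ∑-reflect : ∀ n (f : ℕ → Carrier) → ∑ n f ≈ ∑ n (λ i → f (n ∸ i))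
  ∑-reflect zero    f = refl
  ∑-reflect (suc n) f = begin
    ∑ n f + f (suc n)                   ≈⟨ +-congʳ (∑-reflect n f) ⟩
    ∑ n (λ i → f (n ∸ i)) + f (suc n)   ≈⟨ +-comm _ _ ⟩
    f (suc n) + ∑ n (λ i → f (n ∸ i))   ≈⟨ sym (∑-peel n (λ i → f (suc n ∸ i))) ⟩
    ∑ (suc n) (λ i → f (suc n ∸ i))     ∎

  cast-+ : ∀ m n → cast (m ℕ.+ n) ≈ cast m + cast n
  cast-+ zero    n = sym (+-identityˡ _)
  cast-+ (suc m) n = trans (+-congˡ (cast-+ m n)) (sym (+-assoc _ _ _))

  cast-* : ∀ m n → cast (m ℕ.* n) ≈ cast m * cast n
  cast-* zero    n = sym (zeroˡ _)
  cast-* (suc m) n = begin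
    cast (n ℕ.+ m ℕ.* n)          ≈⟨ cast-+ n (m ℕ.* n) ⟩
    cast n + cast (m ℕ.* n)       ≈⟨ +-cong (sym (*-identityˡ _)) (cast-* m n) ⟩
    1# * cast n + cast m * cast n ≈⟨ sym (distribʳ _ _ _) ⟩
    (1# + cast m) * cast n        ∎

  poch-+ : ∀ u l m → poch u l * poch (cast l + u) m ≈ poch u (l ℕ.+ m)
  poch-+ u l zero    = trans (*-identityʳ _) (≡⇒≈ (P.cong (poch u) (P.sym (ℕₚ.+-identityʳ l))))
  poch-+ u l (suc m) = begin
    poch u l * (poch (cast l + u) m * (cast l + u + cast m)) ≈⟨ sym (*-assoc _ _ _) ⟩
    poch u l * poch (cast l + u) m * (cast l + u + cast m)   ≈⟨ *-cong (poch-+ u l m) shift ⟩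
    poch u (l ℕ.+ m) * (u + cast (l ℕ.+ m))                  ≈⟨ ≡⇒≈ (P.cong (poch u) (P.sym (ℕₚ.+-suc l m))) ⟩
    poch u (l ℕ.+ suc m)                                     ∎
    where
    shift : cast l + u + cast m ≈ u + cast (l ℕ.+ m)
    shift = trans (+-congʳ (+-comm _ _)) (trans (+-assoc _ _ _) (+-congˡ (sym (cast-+ l m))))

  -- It is kept opaque so that its unfolding does not disturb unification.
  opaque
    binomSum : ℕ → (ℕ → ℕ → Carrier) → Carrier
    binomSum n f = ∑ n (λ i → cast (n C i) * f i (n ∸ i))

    binomSum-unfold : ∀ n f → binomSum n f ≈ ∑ n (λ i → cast (n C i) * f i (n ∸ i))
    binomSum-unfold n f = refl

    binomSum-zero : ∀ f → binomSum 0 f ≈ f 0 0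
    binomSum-zero f = trans (*-congʳ (+-identityʳ _)) (*-identityˡ _)

    binomSum-cong : ∀ n {f g : ℕ → ℕ → Carrier} → (∀ i j → f i j ≈ g i j) → binomSum n f ≈ binomSum n g
    binomSum-cong n f≈g = ∑-cong n (λ i → *-congˡ (f≈g i _))

    binomSum-+ : ∀ n (f g : ℕ → ℕ → Carrier) →
      binomSum n (λ i j → f i j + g i j) ≈ binomSum n f + binomSum n g
    binomSum-+ n f g = trans (∑-cong n (λ i → distribˡ _ _ _)) (∑-+ n _ _)

    binomSum-*ˡ : ∀ n x (f : ℕ → ℕ → Carrier) → x * binomSum n f ≈ binomSum n (λ i j → x * f i j)
    binomSum-*ˡ n x f = trans (∑-*ˡ n x _) (∑-cong n (λ i → x∙yz≈y∙xz _ _ _))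

    binomSum-*ʳ : ∀ n x (f : ℕ → ℕ → Carrier) → binomSum n f * x ≈ binomSum n (λ i j → f i j * x)
    binomSum-*ʳ n x f =
      trans (*-comm _ _) (trans (binomSum-*ˡ n x f) (binomSum-cong n (λ i j → *-comm x (f i j))))

    binomSum-suc : ∀ n (f : ℕ → ℕ → Carrier) →
      binomSum (suc n) f ≈ binomSum n (λ i j → f (suc i) j) + binomSum n (λ i j → f i (suc j))
    binomSum-suc n f = begin
      binomSum (suc n) f
        ≈⟨ ∑-peel n _ ⟩
      g 0 + ∑ n (λ i → cast (suc n C suc i) * f (suc i) (n ∸ i))
        ≈⟨ +-congˡ (trans (∑-cong n (λ i → trans (*-congʳ (pascal i)) (distribʳ _ _ _))) (∑-+ n _ _)) ⟩
      g 0 + (binomSum n (λ i j → f (suc i) j) + ∑ n (λ i → g (suc i)))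
        ≈⟨ x+[y+z]≈y+[x+z] _ _ _ ⟩
      binomSum n (λ i j → f (suc i) j) + (g 0 + ∑ n (λ i → g (suc i)))
        ≈⟨ +-congˡ (sym (∑-peel n g)) ⟩
      binomSum n (λ i j → f (suc i) j) + (∑ n g + g (suc n))
        ≈⟨ +-congˡ (trans (+-congˡ last-vanishes) (+-identityʳ _)) ⟩
      binomSum n (λ i j → f (suc i) j) + ∑ n g
        ≈⟨ +-congˡ (∑-cong≤ n (λ i i≤n → *-congˡ (≡⇒≈ (P.cong (f i) (ℕₚ.+-∸-assoc 1 i≤n))))) ⟩
      binomSum n (λ i j → f (suc i) j) + binomSum n (λ i j → f i (suc j)) ∎
      where
      g : ℕ → Carrier
      g i = cast (n C i) * f i (suc n ∸ i)
      pascal : ∀ i → cast (suc n C suc i) ≈ cast (n C i) + cast (n C suc i)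
      pascal i = trans (≡⇒≈ (P.cong cast (P.sym (nCk+nC[k+1]≡[n+1]C[k+1] n i)))) (cast-+ (n C i) _)
      last-vanishes : g (suc n) ≈ 0#
      last-vanishes = trans (*-congʳ (≡⇒≈ (P.cong cast (k>n⇒nCk≡0 {n} {suc n} ℕₚ.≤-refl)))) (zeroˡ _)

  Grid : Set c
  Grid = ℕ → ℕ → Carrier

  _≐_ : Grid → Grid → Set ℓ
  V ≐ W = ∀ u w → V u w ≈ W u w

  Op : Set c
  Op = Grid → Grid

  _⊕_ : Grid → Grid → Grid
  (V ⊕ W) u w = V u w + W u w

  _⊞_ : Op → Op → Op
  (A ⊞ B) W = A W ⊕ B W

  record IsAdditive (A : Op) : Set (c ⊔ ℓ) where
    field
      cong : ∀ {V W} → V ≐ W → A V ≐ A W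
      hom  : ∀ V W → A (V ⊕ W) ≐ (A V ⊕ A W)
  open IsAdditive

  Commute : Op → Op → Set (c ⊔ ℓ)
  Commute A B = ∀ W → A (B W) ≐ B (A W)

  iter : Op → ℕ → Grid → Grid
  iter A zero    W = W
  iter A (suc n) W = iter A n (A W)

  ⊞-additive : ∀ {A B} → IsAdditive A → IsAdditive B → IsAdditive (A ⊞ B)
  ⊞-additive addA addB = record
    { cong = λ V≐W u w → +-cong (cong addA V≐W u w) (cong addB V≐W u w)
    ; hom  = λ V W u w → trans (+-cong (hom addA V W u w) (hom addB V W u w)) (+-interchange _ _ _ _)
    }

  iter-cong : ∀ {A} → IsAdditive A → ∀ n {V W} → V ≐ W → iter A n V ≐ iter A n W
  iter-cong addA zero    V≐W = V≐W
  iter-cong addA (suc n) V≐W = iter-cong addA n (cong addA V≐W)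

  iter-hom : ∀ {A} → IsAdditive A → ∀ n V W → iter A n (V ⊕ W) ≐ (iter A n V ⊕ iter A n W)
  iter-hom addA zero    V W u w = refl
  iter-hom {A} addA (suc n) V W u w =
    trans (iter-cong addA n (hom addA V W) u w) (iter-hom addA n (A V) (A W) u w)

  iter-+ : ∀ A m n W → iter A (m ℕ.+ n) W ≡ iter A n (iter A m W)
  iter-+ A zero    n W = P.refl
  iter-+ A (suc m) n W = iter-+ A m n (A W)

  iter-commute : ∀ {A B} → IsAdditive B → Commute A B → ∀ j W → A (iter B j W) ≐ iter B j (A W)
  iter-commute addB AB zero    W u w = refl
  iter-commute {A} {B} addB AB (suc j) W u w =
    trans (iter-commute addB AB j (B W) u w) (iter-cong addB j (AB W) u w)

  iter-iter-commute : ∀ {A B} → IsAdditive A → IsAdditive B → Commute A B →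
    ∀ i j W → iter A i (iter B j W) ≐ iter B j (iter A i W)
  iter-iter-commute addA addB AB zero    j W u w = refl
  iter-iter-commute {A} addA addB AB (suc i) j W u w =
    trans (iter-cong addA i (iter-commute addB AB j W) u w) (iter-iter-commute addA addB AB i j (A W) u w)

  iter-composite : ∀ {A B} → IsAdditive A → IsAdditive B → Commute A B →
    ∀ L W → iter A L (iter B L W) ≐ iter (λ V → A (B V)) L W
  iter-composite addA addB AB zero    W u w = refl
  iter-composite {A} {B} addA addB AB (suc L) W u w =
    trans (iter-cong addA L (iter-commute addB AB L (B W)) u w) (iter-composite addA addB AB L (A (B W)) u w)

  iter-pointwise : ∀ {T T′} → IsAdditive T′ → (∀ W → T W ≐ T′ W) → ∀ L W → iter T L W ≐ iter T′ L W
  iter-pointwise addT′ T≐T′ zero    W u w = refl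
  iter-pointwise {T} addT′ T≐T′ (suc L) W u w =
    trans (iter-pointwise addT′ T≐T′ L (T W) u w) (iter-cong addT′ L (T≐T′ W) u w)

  binomial-theorem : ∀ {A B} → IsAdditive A → IsAdditive B → Commute A B → ∀ n W u w →
    binomSum n (λ i j → iter A i (iter B j W) u w) ≈ iter (A ⊞ B) n W u w
  binomial-theorem addA addB AB zero W u w = binomSum-zero (λ i j → iter _ i (iter _ j W) u w)
  binomial-theorem {A} {B} addA addB AB (suc n) W u w = begin
    binomSum (suc n) (λ i j → iter A i (iter B j W) u w)
      ≈⟨ binomSum-suc n _ ⟩
    binomSum n (λ i j → iter A i (A (iter B j W)) u w) + binomSum n (λ i j → iter A i (iter B j (B W)) u w)
      ≈⟨ sym (binomSum-+ n _ _) ⟩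
    binomSum n (λ i j → iter A i (A (iter B j W)) u w + iter A i (iter B j (B W)) u w)
      ≈⟨ binomSum-cong n (λ i j → sym (regroup i j)) ⟩
    binomSum n (λ i j → iter A i (iter B j (A W ⊕ B W)) u w)
      ≈⟨ binomial-theorem addA addB AB n (A W ⊕ B W) u w ⟩
    iter (A ⊞ B) (suc n) W u w ∎
    where
    regroup : ∀ i j → iter A i (iter B j (A W ⊕ B W)) u w
                    ≈ iter A i (A (iter B j W)) u w + iter A i (iter B j (B W)) u w
    regroup i j = trans (iter-cong addA i (iter-hom addB j (A W) (B W)) u w)
                 (trans (iter-hom addA i _ _ u w)
                        (+-congʳ (sym (iter-cong addA i (iter-commute addB AB j W) u w))))

  E₁ E₂ E₁₂ : Op
  E₁  W u w = W (suc u) w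
  E₂  W u w = W u (suc w)
  E₁₂ W u w = W (suc u) (suc w)

  scale scaledE₁ scaledE₂ : Carrier → Op
  scale    x W u w = x * W u w
  scaledE₁ x W u w = x * W (suc u) w
  scaledE₂ x W u w = x * W u (suc w)

  E₁-additive : IsAdditive E₁
  E₁-additive = record { cong = λ V≐W u w → V≐W (suc u) w ; hom = λ V W u w → refl }

  E₂-additive : IsAdditive E₂
  E₂-additive = record { cong = λ V≐W u w → V≐W u (suc w) ; hom = λ V W u w → refl }

  E₁₂-additive : IsAdditive E₁₂
  E₁₂-additive = record { cong = λ V≐W u w → V≐W (suc u) (suc w) ; hom = λ V W u w → refl }

  scale-additive : ∀ x → IsAdditive (scale x)
  scale-additive x = record { cong = λ V≐W u w → *-congˡ (V≐W u w) ; hom = λ V W u w → distribˡ x _ _ }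

  scaledE₁-additive : ∀ x → IsAdditive (scaledE₁ x)
  scaledE₁-additive x = record { cong = λ V≐W u w → *-congˡ (V≐W (suc u) w) ; hom = λ V W u w → distribˡ x _ _ }

  scaledE₂-additive : ∀ x → IsAdditive (scaledE₂ x)
  scaledE₂-additive x = record { cong = λ V≐W u w → *-congˡ (V≐W u (suc w)) ; hom = λ V W u w → distribˡ x _ _ }

  iter-E₁ : ∀ i W u w → iter E₁ i W u w ≡ W (i ℕ.+ u) w
  iter-E₁ zero    W u w = P.refl
  iter-E₁ (suc i) W u w = iter-E₁ i (E₁ W) u w

  iter-E₂ : ∀ i W u w → iter E₂ i W u w ≡ W u (i ℕ.+ w)
  iter-E₂ zero    W u w = P.refl
  iter-E₂ (suc i) W u w = iter-E₂ i (E₂ W) u w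

  iter-E₁₂ : ∀ i W u w → iter E₁₂ i W u w ≡ W (i ℕ.+ u) (i ℕ.+ w)
  iter-E₁₂ zero    W u w = P.refl
  iter-E₁₂ (suc i) W u w = iter-E₁₂ i (E₁₂ W) u w

  iter-scale : ∀ x i W u w → iter (scale x) i W u w ≈ pow x i * W u w
  iter-scale x zero    W u w = sym (*-identityˡ _)
  iter-scale x (suc i) W u w = trans (iter-scale x i (scale x W) u w) (x∙yz≈yx∙z _ _ _)

  iter-scaledE₁ : ∀ x i W u w → iter (scaledE₁ x) i W u w ≈ pow x i * W (i ℕ.+ u) w
  iter-scaledE₁ x zero    W u w = sym (*-identityˡ _)
  iter-scaledE₁ x (suc i) W u w = trans (iter-scaledE₁ x i (scaledE₁ x W) u w) (x∙yz≈yx∙z _ _ _)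

  iter-scaledE₂ : ∀ x i W u w → iter (scaledE₂ x) i W u w ≈ pow x i * W u (i ℕ.+ w)
  iter-scaledE₂ x zero    W u w = sym (*-identityˡ _)
  iter-scaledE₂ x (suc i) W u w = trans (iter-scaledE₂ x i (scaledE₂ x W) u w) (x∙yz≈yx∙z _ _ _)

  raise₁ raise₂ : Carrier → Op
  raise₁ x = E₁ ⊞ scale x
  raise₂ x = E₂ ⊞ scale x

  raise₁-additive : ∀ x → IsAdditive (raise₁ x)
  raise₁-additive x = ⊞-additive E₁-additive (scale-additive x)

  raise₂-additive : ∀ x → IsAdditive (raise₂ x)
  raise₂-additive x = ⊞-additive E₂-additive (scale-additive x)

  iter-raise₁ : ∀ x n V u w → iter (raise₁ x) n V u w ≈ binomSum n (λ i j → pow x j * V (i ℕ.+ u) w)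
  iter-raise₁ x n V u w = trans (sym (binomial-theorem E₁-additive (scale-additive x) (λ W u w → refl) n V u w))
    (binomSum-cong n (λ i j → trans (≡⇒≈ (iter-E₁ i (iter (scale x) j V) u w)) (iter-scale x j V (i ℕ.+ u) w)))

  iter-raise₂ : ∀ x n V u w → iter (raise₂ x) n V u w ≈ binomSum n (λ i j → pow x j * V u (i ℕ.+ w))
  iter-raise₂ x n V u w = trans (sym (binomial-theorem E₂-additive (scale-additive x) (λ W u w → refl) n V u w))
    (binomSum-cong n (λ i j → trans (≡⇒≈ (iter-E₂ i (iter (scale x) j V) u w)) (iter-scale x j V u (i ℕ.+ w))))

  Cshift : ℕ → Carrier → Carrier → ℕ → Carrier
  Cshift n a x u = binomSum n (λ i j → pow x j * poch a (i ℕ.+ u))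

  Cpoly≈Cshift : ∀ n a x → Cpoly n a x ≈ Cshift n a x 0
  Cpoly≈Cshift n a x = trans (∑-cong n (λ i → trans (*-assoc _ _ _) (*-congˡ (reorder i))))
    (sym (binomSum-unfold n _))
    where
    reorder : ∀ i → poch a i * pow x (n ∸ i) ≈ pow x (n ∸ i) * poch a (i ℕ.+ 0)
    reorder i = trans (*-comm _ _) (*-congˡ (≡⇒≈ (P.cong (poch a) (P.sym (ℕₚ.+-identityʳ i)))))

  pochGrid : Carrier → Carrier → Grid
  pochGrid a b u w = poch a u * poch b w

  iter-raise-pochGrid : ∀ a b x y n n′ u w →
    iter (raise₁ x) n (iter (raise₂ y) n′ (pochGrid a b)) u w ≈ Cshift n a x u * Cshift n′ b y w
  iter-raise-pochGrid a b x y n n′ u w = begin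
    iter (raise₁ x) n V u w                                   ≈⟨ iter-raise₁ x n V u w ⟩
    binomSum n (λ i j → pow x j * V (i ℕ.+ u) w)               ≈⟨ binomSum-cong n (λ i j → *-congˡ (V-factors (i ℕ.+ u))) ⟩
    binomSum n (λ i j → pow x j * (poch a (i ℕ.+ u) * Cb))     ≈⟨ binomSum-cong n (λ i j → sym (*-assoc _ _ _)) ⟩
    binomSum n (λ i j → pow x j * poch a (i ℕ.+ u) * Cb)       ≈⟨ sym (binomSum-*ʳ n Cb _) ⟩
    Cshift n a x u * Cb                                        ∎
    where
    V : Grid
    V = iter (raise₂ y) n′ (pochGrid a b)
    Cb : Carrier
    Cb = Cshift n′ b y w
    V-factors : ∀ u′ → V u′ w ≈ poch a u′ * Cb
    V-factors u′ = trans (iter-raise₂ y n′ _ u′ w)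
      (trans (binomSum-cong n′ (λ i j → x∙yz≈y∙xz _ _ _)) (sym (binomSum-*ˡ n′ (poch a u′) _)))

  module Expansion (r s : Carrier) where

    mixed diagonal T : Op
    mixed    = scaledE₁ s ⊞ scaledE₂ r
    diagonal = E₁₂ ⊞ mixed
    T        = scale (r * s) ⊞ diagonal

    mixed-additive : IsAdditive mixed
    mixed-additive = ⊞-additive (scaledE₁-additive s) (scaledE₂-additive r)

    diagonal-additive : IsAdditive diagonal
    diagonal-additive = ⊞-additive E₁₂-additive mixed-additive

    T-additive : IsAdditive T
    T-additive = ⊞-additive (scale-additive (r * s)) diagonal-additive

    raise-commute : Commute (raise₁ r) (raise₂ s)
    raise-commute W u w = lemma _ _ _ _ _ _
      where
      lemma : ∀ (x y p q t v : Carrier) → (p + y * q) + x * (t + y * v) ≈ (p + x * t) + y * (q + x * v)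
      lemma = solve 6 (λ x y p q t v → (p :+ y :* q) :+ x :* (t :+ y :* v) := (p :+ x :* t) :+ y :* (q :+ x :* v)) refl

    raise-product : ∀ W → raise₁ r (raise₂ s W) ≐ T W
    raise-product W u w = lemma _ _ _ _ _ _
      where
      lemma : ∀ (x y p q t v : Carrier) → (p + y * q) + x * (t + y * v) ≈ (x * y) * v + (p + (y * q + x * t))
      lemma = solve 6 (λ x y p q t v → (p :+ y :* q) :+ x :* (t :+ y :* v) := (x :* y) :* v :+ (p :+ (y :* q :+ x :* t))) refl

    Inner : Grid → ℕ → ℕ → Carrier
    Inner W l n = binomSum n (λ i₁ i₂ → pow s i₁ * (pow r i₂ * W (i₁ ℕ.+ l) (i₂ ℕ.+ l)))

    Outer : ℕ → Grid → Carrier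
    Outer L W = binomSum L (λ i K → pow (r * s) i * binomSum K (λ l n → Inner W l n))

    iter-mixed : ∀ n W u w → iter mixed n W u w ≈ binomSum n (λ i₁ i₂ → pow s i₁ * (pow r i₂ * W (i₁ ℕ.+ u) (i₂ ℕ.+ w)))
    iter-mixed n W u w = trans (sym (binomial-theorem (scaledE₁-additive s) (scaledE₂-additive r) (λ W u w → x∙yz≈y∙xz _ _ _) n W u w))
      (binomSum-cong n (λ i j → trans (iter-scaledE₁ s i (iter (scaledE₂ r) j W) u w) (*-congˡ (iter-scaledE₂ r j W (i ℕ.+ u) w))))

    iter-diagonal : ∀ n W → iter diagonal n W 0 0 ≈ binomSum n (λ l m → Inner W l m)
    iter-diagonal n W = trans (sym (binomial-theorem E₁₂-additive mixed-additive (λ W u w → refl) n W 0 0))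
      (binomSum-cong n (λ l m → trans (≡⇒≈ (diagonal-shift l m)) (iter-mixed m W l l)))
      where
      diagonal-shift : ∀ l m → iter E₁₂ l (iter mixed m W) 0 0 ≡ iter mixed m W l l
      diagonal-shift l m = P.trans (iter-E₁₂ l (iter mixed m W) 0 0)
                                   (P.cong (λ t → iter mixed m W t t) (ℕₚ.+-identityʳ l))

    iter-T : ∀ L W → iter T L W 0 0 ≈ Outer L W
    iter-T L W = trans (sym (binomial-theorem (scale-additive (r * s)) diagonal-additive scale-commute L W 0 0))
      (binomSum-cong L (λ i K → trans (iter-scale (r * s) i (iter diagonal K W) 0 0) (*-congˡ (iter-diagonal K W))))
      where
      scale-commute : Commute (scale (r * s)) diagonal
      scale-commute W u w = lemma _ _ _ _ _ _
        where
        lemma : ∀ (c₁ x y p q t : Carrier) → c₁ * (p + (x * q + y * t)) ≈ c₁ * p + (x * (c₁ * q) + y * (c₁ * t))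
        lemma = solve 6 (λ c₁ x y p q t → c₁ :* (p :+ (x :* q :+ y :* t)) := c₁ :* p :+ (x :* (c₁ :* q) :+ y :* (c₁ :* t))) refl

    -- The left-hand side coefficient in operator form:
    -- C_{L+M}(a,r) C_{L+N}(b,s) = [(r+E₁)^(L+M) (s+E₂)^(L+N) pochGrid](0,0)
    --                           = [T^L (r+E₁)^M (s+E₂)^N pochGrid](0,0).
    Cpoly-product : ∀ a b L M N →
      Cpoly (L ℕ.+ M) a r * Cpoly (L ℕ.+ N) b s ≈ Outer L (λ u w → Cshift M a r u * Cshift N b s w)
    Cpoly-product a b L M N = begin
      Cpoly (L ℕ.+ M) a r * Cpoly (L ℕ.+ N) b s
        ≈⟨ *-cong (Cpoly≈Cshift (L ℕ.+ M) a r) (Cpoly≈Cshift (L ℕ.+ N) b s) ⟩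
      Cshift (L ℕ.+ M) a r 0 * Cshift (L ℕ.+ N) b s 0
        ≈⟨ sym (iter-raise-pochGrid a b r s (L ℕ.+ M) (L ℕ.+ N) 0 0) ⟩
      iter R₁ (L ℕ.+ M) (iter R₂ (L ℕ.+ N) g) 0 0
        ≈⟨ ≡⇒≈ (P.cong₂ (λ m n → iter R₁ m (iter R₂ n g) 0 0) (ℕₚ.+-comm L M) (ℕₚ.+-comm L N)) ⟩
      iter R₁ (M ℕ.+ L) (iter R₂ (N ℕ.+ L) g) 0 0
        ≈⟨ ≡⇒≈ (P.cong (λ V → V 0 0) (iter-+ R₁ M L _)) ⟩
      iter R₁ L (iter R₁ M (iter R₂ (N ℕ.+ L) g)) 0 0
        ≈⟨ ≡⇒≈ (P.cong (λ W → iter R₁ L (iter R₁ M W) 0 0) (iter-+ R₂ N L g)) ⟩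
      iter R₁ L (iter R₁ M (iter R₂ L (iter R₂ N g))) 0 0
        ≈⟨ iter-cong addR₁ L (iter-iter-commute addR₁ addR₂ raise-commute M L (iter R₂ N g)) 0 0 ⟩
      iter R₁ L (iter R₂ L W₀) 0 0
        ≈⟨ iter-composite addR₁ addR₂ raise-commute L W₀ 0 0 ⟩
      iter (λ V → R₁ (R₂ V)) L W₀ 0 0
        ≈⟨ iter-pointwise T-additive raise-product L W₀ 0 0 ⟩
      iter T L W₀ 0 0
        ≈⟨ iter-cong T-additive L (iter-raise-pochGrid a b r s M N) 0 0 ⟩
      iter T L (λ u w → Cshift M a r u * Cshift N b s w) 0 0
        ≈⟨ iter-T L _ ⟩
      Outer L (λ u w → Cshift M a r u * Cshift N b s w) ∎
      where
      R₁ R₂ : Op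
      R₁ = raise₁ r
      R₂ = raise₂ s
      addR₁ : IsAdditive R₁
      addR₁ = raise₁-additive r
      addR₂ : IsAdditive R₂
      addR₂ = raise₂-additive s
      g W₀ : Grid
      g  = pochGrid a b
      W₀ = iter R₁ M (iter R₂ N g)

binomial-factorials : ∀ {n k} → k ≤ n → (n C k) ℕ.* (k ! ℕ.* (n ∸ k) !) ≡ n !
binomial-factorials {n} {k} k≤n =
  P.trans (P.cong (ℕ._* (k ! ℕ.* (n ∸ k) !)) (nCk≡n!/k![n-k]! k≤n))
          (m/n*n≡m {{k !* (n ∸ k) !≢0}} (k![n∸k]!∣n! k≤n))

reindex : ∀ l n i → l ℕ.+ (n ℕ.+ i) ≡ i ℕ.+ (n ℕ.+ l)
reindex = solve-∀

module InverseFacts {c ℓ : Level} (R : CommutativeRing c ℓ)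
  (inv : ℕ → CommutativeRing.Carrier R)
  (inv-correct : ∀ k → CommutativeRing._≈_ R (CommutativeRing._*_ R (Series.cast R (suc k)) (inv k)) (CommutativeRing.1# R))
  where
  open CommutativeRing R hiding (zero)
  open Series R
  open WithInverses inv
  open RingFacts R
  open import Relation.Binary.Reasoning.Setoid setoid
  open import Algebra.Solver.Ring.NaturalCoefficients commutativeSemiring (λ _ _ → nothing)
    using (solve; _:=_; _:+_; _:*_)
  open import Algebra.Properties.CommutativeSemigroup *-commutativeSemigroup
    using (x∙yz≈y∙xz; interchange)

  fact-invFact : ∀ n → cast (n !) * invFact n ≈ 1#
  fact-invFact zero    = trans (*-identityʳ _) (+-identityʳ _)
  fact-invFact (suc n) = begin
    cast (suc n ℕ.* n !) * (invFact n * inv n)           ≈⟨ *-congʳ (cast-* (suc n) (n !)) ⟩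
    (cast (suc n) * cast (n !)) * (invFact n * inv n)    ≈⟨ *-congˡ (*-comm _ _) ⟩
    (cast (suc n) * cast (n !)) * (inv n * invFact n)    ≈⟨ interchange _ _ _ _ ⟩
    (cast (suc n) * inv n) * (cast (n !) * invFact n)    ≈⟨ *-cong (inv-correct n) (fact-invFact n) ⟩
    1# * 1#                                              ≈⟨ *-identityˡ _ ⟩
    1#                                                   ∎

  invFact-binomial : ∀ {n i} → i ≤ n → invFact i * invFact (n ∸ i) ≈ cast (n C i) * invFact n
  invFact-binomial {n} {i} i≤n = begin
    invFact i * invFact (n ∸ i)
      ≈⟨ sym (trans (*-congˡ (fact-invFact n)) (*-identityʳ _)) ⟩
    invFact i * invFact (n ∸ i) * (cast (n !) * invFact n)
      ≈⟨ *-congˡ (*-congʳ n!-split) ⟩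
    invFact i * invFact (n ∸ i) * ((cast (n C i) * (cast (i !) * cast ((n ∸ i) !))) * invFact n)
      ≈⟨ lemma _ _ _ _ _ _ ⟩
    cast (n C i) * invFact n * ((cast (i !) * invFact i) * (cast ((n ∸ i) !) * invFact (n ∸ i)))
      ≈⟨ *-congˡ (trans (*-cong (fact-invFact i) (fact-invFact (n ∸ i))) (*-identityˡ _)) ⟩
    cast (n C i) * invFact n * 1#
      ≈⟨ *-identityʳ _ ⟩
    cast (n C i) * invFact n ∎
    where
    n!-split : cast (n !) ≈ cast (n C i) * (cast (i !) * cast ((n ∸ i) !))
    n!-split = trans (≡⇒≈ (P.cong cast (P.sym (binomial-factorials i≤n))))
                     (trans (cast-* (n C i) _) (*-congˡ (cast-* (i !) ((n ∸ i) !))))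
    lemma : ∀ (x₁ x₂ x₃ x₄ x₅ x₆ : Carrier) →
      x₁ * x₂ * ((x₃ * (x₄ * x₅)) * x₆) ≈ x₃ * x₆ * ((x₄ * x₁) * (x₅ * x₂))
    lemma = solve 6 (λ x₁ x₂ x₃ x₄ x₅ x₆ →
      x₁ :* x₂ :* ((x₃ :* (x₄ :* x₅)) :* x₆) := x₃ :* x₆ :* ((x₄ :* x₁) :* (x₅ :* x₂))) refl

  invFact-binomSum : ∀ n f →
    invFact n * binomSum n f ≈ ∑ n (λ i → (invFact i * invFact (n ∸ i)) * f i (n ∸ i))
  invFact-binomSum n f = trans (*-congˡ (binomSum-unfold n f)) (trans (∑-*ˡ n _ _)
    (∑-cong≤ n (λ i i≤n → trans (sym (*-assoc _ _ _))
                                (*-congʳ (trans (*-comm _ _) (sym (invFact-binomial i≤n)))))))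

  expTerm : Carrier → ℕ → Carrier
  expTerm x i = pow x i * invFact i

  expTerm-suc : ∀ x i → cast (suc i) * expTerm x (suc i) ≈ x * expTerm x i
  expTerm-suc x i = begin
    cast (suc i) * ((x * pow x i) * (invFact i * inv i)) ≈⟨ x∙yz≈y∙xz _ _ _ ⟩
    (x * pow x i) * (cast (suc i) * (invFact i * inv i)) ≈⟨ *-congˡ (x∙yz≈y∙xz _ _ _) ⟩
    (x * pow x i) * (invFact i * (cast (suc i) * inv i)) ≈⟨ *-congˡ (trans (*-congˡ (inv-correct i)) (*-identityʳ _)) ⟩
    (x * pow x i) * invFact i                            ≈⟨ *-assoc _ _ _ ⟩
    x * expTerm x i                                      ∎

  expTerm-zero : ∀ k → expTerm 0# (suc k) ≈ 0#
  expTerm-zero k = trans (*-congʳ (zeroˡ _)) (zeroˡ _)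

  expTerm-one : ∀ k → expTerm 1# k ≈ invFact k
  expTerm-one k = trans (*-congʳ (pow-one k)) (*-identityˡ _)
    where
    pow-one : ∀ n → pow 1# n ≈ 1#
    pow-one zero    = refl
    pow-one (suc n) = trans (*-identityˡ _) (pow-one n)

  expMonomial : Carrier → Carrier → Carrier → ℕ → ℕ → ℕ → Carrier
  expMonomial x y z i j k = expTerm x i * (expTerm y j * expTerm z k)

  0≈0+0+0 : 0# ≈ 0# + (0# + 0#)
  0≈0+0+0 = sym (trans (+-identityˡ _) (+-identityˡ _))

  1·1≈1 : 1# * 1# ≈ 1#
  1·1≈1 = *-identityˡ 1#

  ⊛-vanishes : ∀ (f g : PS3) I J K → (∀ i j k → i ≤ I → j ≤ J → k ≤ K → f i j k ≈ 0#) → (f ⊛ g) I J K ≈ 0#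
  ⊛-vanishes f g I J K f≈0 =
    ∑-zero I (λ i i≤ → ∑-zero J (λ j j≤ → ∑-zero K (λ k k≤ → trans (*-congʳ (f≈0 i j k i≤ j≤ k≤)) (zeroˡ _))))

  ⊛-distribʳ : ∀ (f f₁ f₂ g : PS3) I J K → (∀ i j k → f i j k ≈ f₁ i j k + f₂ i j k) →
    (f ⊛ g) I J K ≈ (f₁ ⊛ g) I J K + (f₂ ⊛ g) I J K
  ⊛-distribʳ f f₁ f₂ g I J K f≈ =
    trans (∑-cong I (λ i → trans (∑-cong J (λ j →
             trans (∑-cong K (λ k → trans (*-congʳ (f≈ i j k)) (distribʳ _ _ _))) (∑-+ K _ _)))
           (∑-+ J _ _)))
          (∑-+ I _ _)

  SupportedAt : PS3 → ℕ → ℕ → ℕ → Set ℓ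
  SupportedAt f p q t = ∀ i j k → ¬ (i ≡ p × j ≡ q × k ≡ t) → f i j k ≈ 0#

  ⊛-monomialˡ : ∀ (f g : PS3) p q t I J K → SupportedAt f p q t → p ≤ I → q ≤ J → t ≤ K →
    (f ⊛ g) I J K ≈ f p q t * g (I ∸ p) (J ∸ q) (K ∸ t)
  ⊛-monomialˡ f g p q t I J K f-mono p≤ q≤ t≤ =
    trans (∑-single I p p≤ (λ i _ i≢ → ∑-zero J (λ j _ → ∑-zero K (λ k _ →
              trans (*-congʳ (f-mono i j k (λ { (e , _) → i≢ e }))) (zeroˡ _)))))
    (trans (∑-single J q q≤ (λ j _ j≢ → ∑-zero K (λ k _ →
              trans (*-congʳ (f-mono p j k (λ { (_ , e , _) → j≢ e }))) (zeroˡ _))))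
      (∑-single K t t≤ (λ k _ k≢ → trans (*-congʳ (f-mono p q k (λ { (_ , _ , e) → k≢ e }))) (zeroˡ _))))

  ⊛-monomialʳ : ∀ (f g : PS3) p q t I J K → SupportedAt g p q t → p ≤ I → q ≤ J → t ≤ K →
    (f ⊛ g) I J K ≈ f (I ∸ p) (J ∸ q) (K ∸ t) * g p q t
  ⊛-monomialʳ f g p q t I J K g-mono p≤ q≤ t≤ =
    trans (∑-single I (I ∸ p) (ℕₚ.m∸n≤m I p) (λ i i≤ i≢ → ∑-zero J (λ j _ → ∑-zero K (λ k _ →
              trans (*-congˡ (g-mono _ _ _ (λ { (e , _) → i≢ (complement i≤ e) }))) (zeroʳ _)))))
    (trans (∑-single J (J ∸ q) (ℕₚ.m∸n≤m J q) (λ j j≤ j≢ → ∑-zero K (λ k _ →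
              trans (*-congˡ (g-mono _ _ _ (λ { (_ , e , _) → j≢ (complement j≤ e) }))) (zeroʳ _))))
      (trans (∑-single K (K ∸ t) (ℕₚ.m∸n≤m K t) (λ k k≤ k≢ →
              trans (*-congˡ (g-mono _ _ _ (λ { (_ , _ , e) → k≢ (complement k≤ e) }))) (zeroʳ _)))
        (*-congˡ (≡⇒≈ (g-cong₃ (ℕₚ.m∸[m∸n]≡n p≤) (ℕₚ.m∸[m∸n]≡n q≤) (ℕₚ.m∸[m∸n]≡n t≤))))))
    where
    complement : ∀ {n i p} → i ≤ n → n ∸ i ≡ p → i ≡ n ∸ p
    complement {n} i≤n e = P.trans (P.sym (ℕₚ.m∸[m∸n]≡n i≤n)) (P.cong (n ∸_) e)
    g-cong₃ : ∀ {p p′ q q′ t t′} → p′ ≡ p → q′ ≡ q → t′ ≡ t → g p′ q′ t′ ≡ g p q t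
    g-cong₃ P.refl P.refl P.refl = P.refl

  ⊛-separated : ∀ (f g : PS3) I J K → (∀ i j k → k ≢ 0 → f i j k ≈ 0#) → (∀ i j k → j ≢ 0 → g i j k ≈ 0#) →
    (f ⊛ g) I J K ≈ ∑ I (λ i → f i J 0 * g (I ∸ i) 0 K)
  ⊛-separated f g I J K f-noZ g-noY = ∑-cong I (λ i →
    trans (∑-single J J ℕₚ.≤-refl (λ j j≤ j≢ → ∑-zero K (λ k _ →
              trans (*-congˡ (g-noY _ _ _ (λ e → j≢ (ℕₚ.≤-antisym j≤ (ℕₚ.m∸n≡0⇒m≤n e))))) (zeroʳ _))))
      (trans (∑-single K 0 z≤n (λ k _ k≢ → trans (*-congʳ (f-noZ _ _ _ k≢)) (zeroˡ _)))
        (*-congˡ (≡⇒≈ (P.cong (λ j → g (I ∸ i) j K) (ℕₚ.n∸n≡0 J))))))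

  lin-split : ∀ x y z i j k → lin x y z i j k ≈ lin x 0# 0# i j k + (lin 0# y 0# i j k + lin 0# 0# z i j k)
  lin-split x y z zero          zero          zero           = 0≈0+0+0
  lin-split x y z zero          zero          (suc zero)     = sym (trans (+-identityˡ _) (+-identityˡ _))
  lin-split x y z zero          zero          (suc (suc k))  = 0≈0+0+0
  lin-split x y z zero          (suc zero)    zero           = sym (trans (+-identityˡ _) (+-identityʳ _))
  lin-split x y z zero          (suc zero)    (suc k)        = 0≈0+0+0
  lin-split x y z zero          (suc (suc j)) k              = 0≈0+0+0
  lin-split x y z (suc zero)    zero          zero           = sym (trans (+-congˡ (+-identityˡ _)) (+-identityʳ _))
  lin-split x y z (suc zero)    zero          (suc k)        = 0≈0+0+0
  lin-split x y z (suc zero)    (suc j)       k              = 0≈0+0+0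
  lin-split x y z (suc (suc i)) j             k              = 0≈0+0+0

  linX-monomial : ∀ x → SupportedAt (lin x 0# 0#) 1 0 0
  linX-monomial x zero          zero          zero          _  = refl
  linX-monomial x zero          zero          (suc zero)    _  = refl
  linX-monomial x zero          zero          (suc (suc k)) _  = refl
  linX-monomial x zero          (suc zero)    zero          _  = refl
  linX-monomial x zero          (suc zero)    (suc k)       _  = refl
  linX-monomial x zero          (suc (suc j)) k             _  = refl
  linX-monomial x (suc zero)    zero          zero          ≠p = ⊥-elim (≠p (P.refl , P.refl , P.refl))
  linX-monomial x (suc zero)    zero          (suc k)       _  = refl
  linX-monomial x (suc zero)    (suc j)       k             _  = refl
  linX-monomial x (suc (suc i)) j             k             _  = refl

  linY-monomial : ∀ y → SupportedAt (lin 0# y 0#) 0 1 0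
  linY-monomial y zero          zero          zero          _  = refl
  linY-monomial y zero          zero          (suc zero)    _  = refl
  linY-monomial y zero          zero          (suc (suc k)) _  = refl
  linY-monomial y zero          (suc zero)    zero          ≠p = ⊥-elim (≠p (P.refl , P.refl , P.refl))
  linY-monomial y zero          (suc zero)    (suc k)       _  = refl
  linY-monomial y zero          (suc (suc j)) k             _  = refl
  linY-monomial y (suc zero)    zero          zero          _  = refl
  linY-monomial y (suc zero)    zero          (suc k)       _  = refl
  linY-monomial y (suc zero)    (suc j)       k             _  = refl
  linY-monomial y (suc (suc i)) j             k             _  = refl

  linZ-monomial : ∀ z → SupportedAt (lin 0# 0# z) 0 0 1
  linZ-monomial z zero          zero          zero          _  = refl
  linZ-monomial z zero          zero          (suc zero)    ≠p = ⊥-elim (≠p (P.refl , P.refl , P.refl))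
  linZ-monomial z zero          zero          (suc (suc k)) _  = refl
  linZ-monomial z zero          (suc zero)    zero          _  = refl
  linZ-monomial z zero          (suc zero)    (suc k)       _  = refl
  linZ-monomial z zero          (suc (suc j)) k             _  = refl
  linZ-monomial z (suc zero)    zero          zero          _  = refl
  linZ-monomial z (suc zero)    zero          (suc k)       _  = refl
  linZ-monomial z (suc zero)    (suc j)       k             _  = refl
  linZ-monomial z (suc (suc i)) j             k             _  = refl

  mulX mulY mulZ : Carrier → PS3 → PS3
  mulX x Q zero    j k = 0#
  mulX x Q (suc i) j k = x * Q i j k
  mulY y Q i zero    k = 0#
  mulY y Q i (suc j) k = y * Q i j k
  mulZ z Q i j zero    = 0#
  mulZ z Q i j (suc k) = z * Q i j k

  lin-⊛ : ∀ x y z (Q : PS3) i j k →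
    (lin x y z ⊛ Q) i j k ≈ mulX x Q i j k + (mulY y Q i j k + mulZ z Q i j k)
  lin-⊛ x y z Q i j k =
    trans (⊛-distribʳ (lin x y z) (lin x 0# 0#) _ Q i j k (lin-split x y z))
      (+-cong (linX-⊛ i j k) (trans (⊛-distribʳ _ (lin 0# y 0#) (lin 0# 0# z) Q i j k (λ _ _ _ → refl))
                                    (+-cong (linY-⊛ i j k) (linZ-⊛ i j k))))
    where
    linX-⊛ : ∀ i j k → (lin x 0# 0# ⊛ Q) i j k ≈ mulX x Q i j k
    linX-⊛ zero j k =
      ⊛-vanishes (lin x 0# 0#) Q 0 j k (λ { .zero j k z≤n _ _ → linX-monomial x 0 j k (λ { (() , _) }) })
    linX-⊛ (suc i) j k = ⊛-monomialˡ (lin x 0# 0#) Q 1 0 0 (suc i) j k (linX-monomial x) (s≤s z≤n) z≤n z≤n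
    linY-⊛ : ∀ i j k → (lin 0# y 0# ⊛ Q) i j k ≈ mulY y Q i j k
    linY-⊛ i zero k =
      ⊛-vanishes (lin 0# y 0#) Q i 0 k (λ { i .zero k _ z≤n _ → linY-monomial y i 0 k (λ { (_ , () , _) }) })
    linY-⊛ i (suc j) k = ⊛-monomialˡ (lin 0# y 0#) Q 0 1 0 i (suc j) k (linY-monomial y) z≤n (s≤s z≤n) z≤n
    linZ-⊛ : ∀ i j k → (lin 0# 0# z ⊛ Q) i j k ≈ mulZ z Q i j k
    linZ-⊛ i j zero =
      ⊛-vanishes (lin 0# 0# z) Q i j 0 (λ { i j .zero _ _ z≤n → linZ-monomial z i j 0 (λ { (_ , _ , ()) }) })
    linZ-⊛ i j (suc k) = ⊛-monomialˡ (lin 0# 0# z) Q 0 0 1 i j (suc k) (linZ-monomial z) z≤n z≤n (s≤s z≤n)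

  module Multinomial (x y z : Carrier) where

    Λ : ℕ → PS3
    Λ = powPS (lin x y z)

    OnDegree OffDegree : ℕ → Set ℓ
    OnDegree  m = ∀ i j k → i ℕ.+ j ℕ.+ k ≡ m → invFact m * Λ m i j k ≈ expMonomial x y z i j k
    OffDegree m = ∀ i j k → i ℕ.+ j ℕ.+ k ≢ m → invFact m * Λ m i j k ≈ 0#

    on-zero : OnDegree 0
    on-zero zero    zero    zero    _ = trans 1·1≈1 (sym (trans (*-cong 1·1≈1 (trans (*-cong 1·1≈1 1·1≈1) 1·1≈1)) 1·1≈1))
    on-zero zero    zero    (suc k) ()
    on-zero zero    (suc j) k       ()
    on-zero (suc i) j       k       ()

    off-zero : OffDegree 0
    off-zero zero    zero    zero    ≢0 = ⊥-elim (≢0 P.refl)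
    off-zero zero    zero    (suc k) _  = zeroʳ _
    off-zero zero    (suc j) k       _  = zeroʳ _
    off-zero (suc i) j       k       _  = zeroʳ _

    degree-sucY : ∀ i j k → i ℕ.+ suc j ℕ.+ k ≡ suc (i ℕ.+ j ℕ.+ k)
    degree-sucY i j k = P.cong (ℕ._+ k) (ℕₚ.+-suc i j)

    degree-sucZ : ∀ i j k → i ℕ.+ j ℕ.+ suc k ≡ suc (i ℕ.+ j ℕ.+ k)
    degree-sucZ i j k = ℕₚ.+-suc (i ℕ.+ j) k

    module Step (m : ℕ) (on : OnDegree m) (off : OffDegree m) where

      mulX-on : ∀ i j k → i ℕ.+ j ℕ.+ k ≡ suc m → invFact m * mulX x (Λ m) i j k ≈ cast i * expMonomial x y z i j k
      mulX-on zero    j k _ = trans (zeroʳ _) (sym (zeroˡ _))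
      mulX-on (suc i) j k e = begin
        invFact m * (x * Λ m i j k)                          ≈⟨ x∙yz≈y∙xz _ _ _ ⟩
        x * (invFact m * Λ m i j k)                          ≈⟨ *-congˡ (on i j k (ℕₚ.suc-injective e)) ⟩
        x * (expTerm x i * (expTerm y j * expTerm z k))      ≈⟨ sym (*-assoc _ _ _) ⟩
        (x * expTerm x i) * (expTerm y j * expTerm z k)      ≈⟨ *-congʳ (sym (expTerm-suc x i)) ⟩
        (cast (suc i) * expTerm x (suc i)) * (expTerm y j * expTerm z k) ≈⟨ *-assoc _ _ _ ⟩
        cast (suc i) * expMonomial x y z (suc i) j k         ∎

      mulY-on : ∀ i j k → i ℕ.+ j ℕ.+ k ≡ suc m → invFact m * mulY y (Λ m) i j k ≈ cast j * expMonomial x y z i j k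
      mulY-on i zero    k _ = trans (zeroʳ _) (sym (zeroˡ _))
      mulY-on i (suc j) k e = begin
        invFact m * (y * Λ m i j k)                          ≈⟨ x∙yz≈y∙xz _ _ _ ⟩
        y * (invFact m * Λ m i j k)                          ≈⟨ *-congˡ (on i j k (ℕₚ.suc-injective (P.trans (P.sym (degree-sucY i j k)) e))) ⟩
        y * (expTerm x i * (expTerm y j * expTerm z k))      ≈⟨ x∙yz≈y∙xz _ _ _ ⟩
        expTerm x i * (y * (expTerm y j * expTerm z k))      ≈⟨ *-congˡ (sym (*-assoc _ _ _)) ⟩
        expTerm x i * ((y * expTerm y j) * expTerm z k)      ≈⟨ *-congˡ (*-congʳ (sym (expTerm-suc y j))) ⟩
        expTerm x i * ((cast (suc j) * expTerm y (suc j)) * expTerm z k) ≈⟨ *-congˡ (*-assoc _ _ _) ⟩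
        expTerm x i * (cast (suc j) * (expTerm y (suc j) * expTerm z k)) ≈⟨ x∙yz≈y∙xz _ _ _ ⟩
        cast (suc j) * expMonomial x y z i (suc j) k         ∎

      mulZ-on : ∀ i j k → i ℕ.+ j ℕ.+ k ≡ suc m → invFact m * mulZ z (Λ m) i j k ≈ cast k * expMonomial x y z i j k
      mulZ-on i j zero    _ = trans (zeroʳ _) (sym (zeroˡ _))
      mulZ-on i j (suc k) e = begin
        invFact m * (z * Λ m i j k)                          ≈⟨ x∙yz≈y∙xz _ _ _ ⟩
        z * (invFact m * Λ m i j k)                          ≈⟨ *-congˡ (on i j k (ℕₚ.suc-injective (P.trans (P.sym (degree-sucZ i j k)) e))) ⟩
        z * (expTerm x i * (expTerm y j * expTerm z k))      ≈⟨ x∙yz≈y∙xz _ _ _ ⟩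
        expTerm x i * (z * (expTerm y j * expTerm z k))      ≈⟨ *-congˡ (x∙yz≈y∙xz _ _ _) ⟩
        expTerm x i * (expTerm y j * (z * expTerm z k))      ≈⟨ *-congˡ (*-congˡ (sym (expTerm-suc z k))) ⟩
        expTerm x i * (expTerm y j * (cast (suc k) * expTerm z (suc k))) ≈⟨ *-congˡ (x∙yz≈y∙xz _ _ _) ⟩
        expTerm x i * (cast (suc k) * (expTerm y j * expTerm z (suc k))) ≈⟨ x∙yz≈y∙xz _ _ _ ⟩
        cast (suc k) * expMonomial x y z i j (suc k)         ∎

      mulX-off : ∀ i j k → i ℕ.+ j ℕ.+ k ≢ suc m → invFact m * mulX x (Λ m) i j k ≈ 0#
      mulX-off zero    j k _  = zeroʳ _
      mulX-off (suc i) j k ≢ = trans (x∙yz≈y∙xz _ _ _) (trans (*-congˡ (off i j k (λ e → ≢ (P.cong suc e)))) (zeroʳ _))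

      mulY-off : ∀ i j k → i ℕ.+ j ℕ.+ k ≢ suc m → invFact m * mulY y (Λ m) i j k ≈ 0#
      mulY-off i zero    k _  = zeroʳ _
      mulY-off i (suc j) k ≢ =
        trans (x∙yz≈y∙xz _ _ _) (trans (*-congˡ (off i j k (λ e → ≢ (P.trans (degree-sucY i j k) (P.cong suc e))))) (zeroʳ _))

      mulZ-off : ∀ i j k → i ℕ.+ j ℕ.+ k ≢ suc m → invFact m * mulZ z (Λ m) i j k ≈ 0#
      mulZ-off i j zero    _  = zeroʳ _
      mulZ-off i j (suc k) ≢ =
        trans (x∙yz≈y∙xz _ _ _) (trans (*-congˡ (off i j k (λ e → ≢ (P.trans (degree-sucZ i j k) (P.cong suc e))))) (zeroʳ _))

      expand : ∀ i j k → invFact (suc m) * Λ (suc m) i j k ≈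
        inv m * (invFact m * mulX x (Λ m) i j k + (invFact m * mulY y (Λ m) i j k + invFact m * mulZ z (Λ m) i j k))
      expand i j k = trans (*-congˡ (lin-⊛ x y z (Λ m) i j k)) (lemma _ _ _ _ _)
        where
        lemma : ∀ (f v a b c′ : Carrier) → (f * v) * (a + (b + c′)) ≈ v * (f * a + (f * b + f * c′))
        lemma = solve 5 (λ f v a b c′ → (f :* v) :* (a :+ (b :+ c′)) := v :* (f :* a :+ (f :* b :+ f :* c′))) refl

      on-suc : OnDegree (suc m)
      on-suc i j k e = begin
        invFact (suc m) * Λ (suc m) i j k
          ≈⟨ expand i j k ⟩
        inv m * (invFact m * mulX x (Λ m) i j k + (invFact m * mulY y (Λ m) i j k + invFact m * mulZ z (Λ m) i j k))
          ≈⟨ *-congˡ (+-cong (mulX-on i j k e) (+-cong (mulY-on i j k e) (mulZ-on i j k e))) ⟩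
        inv m * (cast i * E + (cast j * E + cast k * E))
          ≈⟨ lemma _ _ _ _ _ ⟩
        (((cast i + cast j) + cast k) * inv m) * E
          ≈⟨ *-congʳ (*-congʳ (sym (trans (cast-+ (i ℕ.+ j) k) (+-congʳ (cast-+ i j))))) ⟩
        (cast (i ℕ.+ j ℕ.+ k) * inv m) * E
          ≈⟨ *-congʳ (trans (*-congʳ (≡⇒≈ (P.cong cast e))) (inv-correct m)) ⟩
        1# * E
          ≈⟨ *-identityˡ _ ⟩
        E ∎
        where
        E : Carrier
        E = expMonomial x y z i j k
        lemma : ∀ (v a b c′ M : Carrier) → v * (a * M + (b * M + c′ * M)) ≈ (((a + b) + c′) * v) * M
        lemma = solve 5 (λ v a b c′ M → v :* (a :* M :+ (b :* M :+ c′ :* M)) := (((a :+ b) :+ c′) :* v) :* M) refl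

      off-suc : OffDegree (suc m)
      off-suc i j k ≢ = trans (expand i j k)
        (trans (*-congˡ (+-cong (mulX-off i j k ≢) (+-cong (mulY-off i j k ≢) (mulZ-off i j k ≢))))
          (trans (*-congˡ (sym 0≈0+0+0)) (zeroʳ _)))

    multinomial : ∀ m → OnDegree m × OffDegree m
    multinomial zero    = on-zero , off-zero
    multinomial (suc m) = let (on , off) = multinomial m in Step.on-suc m on off , Step.off-suc m on off

  compose-lin : ∀ (cf c′ : ℕ → Carrier) x y z → (∀ m → cf m ≈ c′ m * invFact m) →
    ∀ i j k → compose cf (lin x y z) i j k ≈ c′ (i ℕ.+ j ℕ.+ k) * expMonomial x y z i j k
  compose-lin cf c′ x y z cf≈ i j k =
    trans (∑-single (i ℕ.+ j ℕ.+ k) (i ℕ.+ j ℕ.+ k) ℕₚ.≤-refl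
             (λ m _ m≢ → trans (split m) (trans (*-congˡ (proj₂ (multinomial m) i j k (λ e → m≢ (P.sym e)))) (zeroʳ _))))
          (trans (split _) (*-congˡ (proj₁ (multinomial _) i j k P.refl)))
    where
    open Multinomial x y z using (Λ; multinomial)
    split : ∀ m → cf m * Λ m i j k ≈ c′ m * (invFact m * Λ m i j k)
    split m = trans (*-congʳ (cf≈ m)) (*-assoc _ _ _)

  xmono-monomial : ∀ l c → SupportedAt (xmono l c) l 0 0
  xmono-monomial l c i zero zero ≠p with i ℕ.≟ l
  ... | yes i≡l = ⊥-elim (≠p (i≡l , P.refl , P.refl))
  ... | no  _   = refl
  xmono-monomial l c i zero    (suc k) _ = refl
  xmono-monomial l c i (suc j) k       _ = refl

  xmono-at : ∀ l c → xmono l c l 0 0 ≈ c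
  xmono-at l c with l ℕ.≟ l
  ... | yes _   = refl
  ... | no  l≢l = ⊥-elim (l≢l P.refl)

  -- Σ_j x^j/j! · (a)_l (l+a)_(n + (M-j)) / (M-j)!  =  Cshift M a x (n+l) / M!.
  -- This is the convolution of e^(x Y) with (1 - Y)^(-(l+a)) after restoring (a)_l.
  Cshift-convolution : ∀ x a l n M →
    ∑ M (λ j → expTerm x j * invFact (M ∸ j) * (poch a l * poch (cast l + a) (n ℕ.+ (M ∸ j))))
      ≈ invFact M * Cshift M a x (n ℕ.+ l)
  Cshift-convolution x a l n M = trans (∑-reflect M _) (trans (∑-cong≤ M term) (sym (invFact-binomSum M _)))
    where
    term : ∀ i → i ≤ M →
      expTerm x (M ∸ i) * invFact (M ∸ (M ∸ i)) * (poch a l * poch (cast l + a) (n ℕ.+ (M ∸ (M ∸ i))))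
        ≈ (invFact i * invFact (M ∸ i)) * (pow x (M ∸ i) * poch a (i ℕ.+ (n ℕ.+ l)))
    term i i≤M = begin
      expTerm x (M ∸ i) * invFact (M ∸ (M ∸ i)) * (poch a l * poch (cast l + a) (n ℕ.+ (M ∸ (M ∸ i))))
        ≈⟨ ≡⇒≈ (P.cong (λ t → expTerm x (M ∸ i) * invFact t * (poch a l * poch (cast l + a) (n ℕ.+ t)))
                        (ℕₚ.m∸[m∸n]≡n i≤M)) ⟩
      (pow x (M ∸ i) * invFact (M ∸ i)) * invFact i * (poch a l * poch (cast l + a) (n ℕ.+ i))
        ≈⟨ *-congˡ (trans (poch-+ a l (n ℕ.+ i)) (≡⇒≈ (P.cong (poch a) (reindex l n i)))) ⟩
      (pow x (M ∸ i) * invFact (M ∸ i)) * invFact i * poch a (i ℕ.+ (n ℕ.+ l))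
        ≈⟨ lemma _ _ _ _ ⟩
      (invFact i * invFact (M ∸ i)) * (pow x (M ∸ i) * poch a (i ℕ.+ (n ℕ.+ l))) ∎
      where
      lemma : ∀ (p q t v : Carrier) → (p * q) * t * v ≈ (t * q) * (p * v)
      lemma = solve 4 (λ p q t v → (p :* q) :* t :* v := (t :* q) :* (p :* v)) refl

  module RightHandSide (a b r s : Carrier) where

    B₁ B₂ : ℕ → PS3
    B₁ l = binomPS (cast l + a) (lin s 1# 0#)
    B₂ l = binomPS (cast l + b) (lin r 0# 1#)

    coeff : ℕ → Carrier
    coeff l = poch a l * poch b l * invFact l

    B₁-coeff : ∀ l i j k → B₁ l i j k ≈ poch (cast l + a) (i ℕ.+ j ℕ.+ k) * expMonomial s 1# 0# i j k
    B₁-coeff l = compose-lin _ (poch (cast l + a)) s 1# 0# (λ m → refl)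

    B₂-coeff : ∀ l i j k → B₂ l i j k ≈ poch (cast l + b) (i ℕ.+ j ℕ.+ k) * expMonomial r 0# 1# i j k
    B₂-coeff l = compose-lin _ (poch (cast l + b)) r 0# 1# (λ m → refl)

    B₁-noZ : ∀ l i j k → k ≢ 0 → B₁ l i j k ≈ 0#
    B₁-noZ l i j zero    k≢0 = ⊥-elim (k≢0 P.refl)
    B₁-noZ l i j (suc k) _   = trans (B₁-coeff l i j (suc k))
      (trans (*-congˡ (trans (*-congˡ (trans (*-congˡ (expTerm-zero k)) (zeroʳ _))) (zeroʳ _))) (zeroʳ _))

    B₂-noY : ∀ l i j k → j ≢ 0 → B₂ l i j k ≈ 0#
    B₂-noY l i zero    k j≢0 = ⊥-elim (j≢0 P.refl)
    B₂-noY l i (suc j) k _   = trans (B₂-coeff l i (suc j) k)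
      (trans (*-congˡ (trans (*-congˡ (trans (*-congʳ (expTerm-zero j)) (zeroˡ _))) (zeroʳ _))) (zeroʳ _))

    B₁c B₂c : ℕ → ℕ → ℕ → Carrier
    B₁c l i J = poch (cast l + a) (i ℕ.+ J) * (expTerm s i * invFact J)
    B₂c l i K = poch (cast l + b) (i ℕ.+ K) * (expTerm r i * invFact K)

    B₁-at : ∀ l i J → B₁ l i J 0 ≈ B₁c l i J
    B₁-at l i J = trans (B₁-coeff l i J 0) (*-cong
      (≡⇒≈ (P.cong (poch (cast l + a)) (ℕₚ.+-identityʳ (i ℕ.+ J))))
      (*-congˡ (trans (*-cong (expTerm-one J) 1·1≈1) (*-identityʳ _))))

    B₂-at : ∀ l i K → B₂ l i 0 K ≈ B₂c l i K
    B₂-at l i K = trans (B₂-coeff l i 0 K) (*-cong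
      (≡⇒≈ (P.cong (λ t → poch (cast l + b) (t ℕ.+ K)) (ℕₚ.+-identityʳ i)))
      (*-congˡ (trans (*-cong 1·1≈1 (expTerm-one K)) (*-identityˡ _))))

    twoSeries : ℕ → ℕ → ℕ → ℕ → Carrier
    twoSeries l n J K = ∑ n (λ i₁ → B₁c l i₁ J * B₂c l (n ∸ i₁) K)

    rhsTerm-coeff : ∀ l I J K → l ≤ I → rhsTerm a b r s l I J K ≈ twoSeries l (I ∸ l) J K * coeff l
    rhsTerm-coeff l I J K l≤I =
      trans (⊛-monomialʳ (B₁ l ⊛ B₂ l) (xmono l (coeff l)) l 0 0 I J K (xmono-monomial l (coeff l)) l≤I z≤n z≤n)
        (*-cong (trans (⊛-separated (B₁ l) (B₂ l) (I ∸ l) J K (B₁-noZ l) (B₂-noY l))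
                       (∑-cong (I ∸ l) (λ i → *-cong (B₁-at l i J) (B₂-at l ((I ∸ l) ∸ i) K))))
                (xmono-at l (coeff l)))

    rhsSum-coeff : ∀ I J K → rhsSum a b r s I J K ≈ ∑ I (λ l → twoSeries l (I ∸ l) J K * coeff l)
    rhsSum-coeff I J K = ∑-cong≤ I (λ l l≤I → rhsTerm-coeff l I J K l≤I)

    exp-coeff : ∀ i j k → expPS (lin (r * s) r s) i j k ≈ expMonomial (r * s) r s i j k
    exp-coeff i j k = trans (compose-lin invFact (λ _ → 1#) (r * s) r s (λ m → sym (*-identityˡ _)) i j k) (*-identityˡ _)

    module Collapse (M N : ℕ) where
      open Expansion r s using (Inner; Outer)

      W : Grid
      W u w = Cshift M a r u * Cshift N b s w

      invFactMN : Carrier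
      invFactMN = invFact M * invFact N

      yz-sum : ∀ l i₁ i₂ →
        ∑ M (λ j → ∑ N (λ k → (expTerm r j * expTerm s k) * ((B₁c l i₁ (M ∸ j) * B₂c l i₂ (N ∸ k)) * coeff l)))
          ≈ invFactMN * (invFact l * ((invFact i₁ * invFact i₂) * (pow s i₁ * (pow r i₂ * W (i₁ ℕ.+ l) (i₂ ℕ.+ l)))))
      yz-sum l i₁ i₂ = begin
        ∑ M (λ j → ∑ N (λ k → (expTerm r j * expTerm s k) * ((B₁c l i₁ (M ∸ j) * B₂c l i₂ (N ∸ k)) * coeff l)))
          ≈⟨ ∑-cong M (λ j → trans (∑-cong N (λ k → separate _ _ _ _ _ _ _ _ _ _ _)) (sym (∑-*ˡ N c₀ _))) ⟩
        ∑ M (λ j → c₀ * ∑ N (λ k → F j * G k))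
          ≈⟨ trans (sym (∑-*ˡ M c₀ _)) (*-congˡ (∑∑-product M N F G)) ⟩
        c₀ * (∑ M F * ∑ N G)
          ≈⟨ *-congˡ (*-cong (Cshift-convolution r a l i₁ M) (Cshift-convolution s b l i₂ N)) ⟩
        c₀ * ((invFact M * Cshift M a r (i₁ ℕ.+ l)) * (invFact N * Cshift N b s (i₂ ℕ.+ l)))
          ≈⟨ regroup _ _ _ _ _ _ _ _ _ ⟩
        invFactMN * (invFact l * ((invFact i₁ * invFact i₂) * (pow s i₁ * (pow r i₂ * W (i₁ ℕ.+ l) (i₂ ℕ.+ l))))) ∎
        where
        c₀ : Carrier
        c₀ = expTerm s i₁ * expTerm r i₂ * invFact l
        F G : ℕ → Carrier
        F j = expTerm r j * invFact (M ∸ j) * (poch a l * poch (cast l + a) (i₁ ℕ.+ (M ∸ j)))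
        G k = expTerm s k * invFact (N ∸ k) * (poch b l * poch (cast l + b) (i₂ ℕ.+ (N ∸ k)))
        separate : ∀ (e₁ e₂ P₁ s₁ f₁ P₂ r₂ f₂ q₁ q₂ fl : Carrier) →
          (e₁ * e₂) * (((P₁ * (s₁ * f₁)) * (P₂ * (r₂ * f₂))) * ((q₁ * q₂) * fl))
            ≈ (s₁ * r₂ * fl) * ((e₁ * f₁ * (q₁ * P₁)) * (e₂ * f₂ * (q₂ * P₂)))
        separate = solve 11 (λ e₁ e₂ P₁ s₁ f₁ P₂ r₂ f₂ q₁ q₂ fl →
          (e₁ :* e₂) :* (((P₁ :* (s₁ :* f₁)) :* (P₂ :* (r₂ :* f₂))) :* ((q₁ :* q₂) :* fl))
            := (s₁ :* r₂ :* fl) :* ((e₁ :* f₁ :* (q₁ :* P₁)) :* (e₂ :* f₂ :* (q₂ :* P₂)))) refl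
        regroup : ∀ (ps₁ f₁ pr₂ f₂ fl fM A fN B : Carrier) →
          ((ps₁ * f₁) * (pr₂ * f₂) * fl) * ((fM * A) * (fN * B))
            ≈ (fM * fN) * (fl * ((f₁ * f₂) * (ps₁ * (pr₂ * (A * B)))))
        regroup = solve 9 (λ ps₁ f₁ pr₂ f₂ fl fM A fN B →
          ((ps₁ :* f₁) :* (pr₂ :* f₂) :* fl) :* ((fM :* A) :* (fN :* B))
            := (fM :* fN) :* (fl :* ((f₁ :* f₂) :* (ps₁ :* (pr₂ :* (A :* B)))))) refl

      i₁-sum : ∀ l n →
        ∑ M (λ j → ∑ N (λ k → (expTerm r j * expTerm s k) * (twoSeries l n (M ∸ j) (N ∸ k) * coeff l)))
          ≈ invFactMN * (invFact l * (invFact n * Inner W l n))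
      i₁-sum l n = begin
        ∑ M (λ j → ∑ N (λ k → (expTerm r j * expTerm s k) * (twoSeries l n (M ∸ j) (N ∸ k) * coeff l)))
          ≈⟨ ∑-cong M (λ j → ∑-cong N (λ k → trans (*-congˡ (∑-*ʳ n (coeff l) _)) (∑-*ˡ n _ _))) ⟩
        ∑ M (λ j → ∑ N (λ k → ∑ n (λ i₁ → (expTerm r j * expTerm s k) * ((B₁c l i₁ (M ∸ j) * B₂c l (n ∸ i₁) (N ∸ k)) * coeff l))))
          ≈⟨ ∑-rotate M N n _ ⟩
        ∑ n (λ i₁ → ∑ M (λ j → ∑ N (λ k → (expTerm r j * expTerm s k) * ((B₁c l i₁ (M ∸ j) * B₂c l (n ∸ i₁) (N ∸ k)) * coeff l))))
          ≈⟨ ∑-cong n (λ i₁ → yz-sum l i₁ (n ∸ i₁)) ⟩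
        ∑ n (λ i₁ → invFactMN * (invFact l * Y i₁))
          ≈⟨ trans (sym (∑-*ˡ n invFactMN _)) (*-congˡ (sym (∑-*ˡ n (invFact l) Y))) ⟩
        invFactMN * (invFact l * ∑ n Y)
          ≈⟨ *-congˡ (*-congˡ (sym (invFact-binomSum n _))) ⟩
        invFactMN * (invFact l * (invFact n * Inner W l n)) ∎
        where
        Y : ℕ → Carrier
        Y i₁ = (invFact i₁ * invFact (n ∸ i₁)) * (pow s i₁ * (pow r (n ∸ i₁) * W (i₁ ℕ.+ l) ((n ∸ i₁) ℕ.+ l)))

      l-sum : ∀ K →
        ∑ M (λ j → ∑ N (λ k → (expTerm r j * expTerm s k) * ∑ K (λ l → twoSeries l (K ∸ l) (M ∸ j) (N ∸ k) * coeff l)))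
          ≈ invFactMN * (invFact K * binomSum K (Inner W))
      l-sum K = begin
        ∑ M (λ j → ∑ N (λ k → (expTerm r j * expTerm s k) * ∑ K (λ l → twoSeries l (K ∸ l) (M ∸ j) (N ∸ k) * coeff l)))
          ≈⟨ ∑-cong M (λ j → ∑-cong N (λ k → ∑-*ˡ K _ _)) ⟩
        ∑ M (λ j → ∑ N (λ k → ∑ K (λ l → (expTerm r j * expTerm s k) * (twoSeries l (K ∸ l) (M ∸ j) (N ∸ k) * coeff l))))
          ≈⟨ ∑-rotate M N K _ ⟩
        ∑ K (λ l → ∑ M (λ j → ∑ N (λ k → (expTerm r j * expTerm s k) * (twoSeries l (K ∸ l) (M ∸ j) (N ∸ k) * coeff l))))
          ≈⟨ ∑-cong K (λ l → trans (i₁-sum l (K ∸ l)) (*-congˡ (sym (*-assoc _ _ _)))) ⟩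
        ∑ K (λ l → invFactMN * ((invFact l * invFact (K ∸ l)) * Inner W l (K ∸ l)))
          ≈⟨ sym (∑-*ˡ K invFactMN _) ⟩
        invFactMN * ∑ K (λ l → (invFact l * invFact (K ∸ l)) * Inner W l (K ∸ l))
          ≈⟨ *-congˡ (sym (invFact-binomSum K _)) ⟩
        invFactMN * (invFact K * binomSum K (Inner W)) ∎

      RHS-coeff : ∀ L → RHS a b r s L M N ≈ invFactMN * (invFact L * Outer L W)
      RHS-coeff L = begin
        RHS a b r s L M N
          ≈⟨ ∑-cong L x-term ⟩
        ∑ L (λ i → expTerm (r * s) i * (invFactMN * (invFact (L ∸ i) * binomSum (L ∸ i) (Inner W))))
          ≈⟨ ∑-cong L (λ i → regroup _ _ _ _ _) ⟩
        ∑ L (λ i → invFactMN * ((invFact i * invFact (L ∸ i)) * (pow (r * s) i * binomSum (L ∸ i) (Inner W))))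
          ≈⟨ sym (∑-*ˡ L invFactMN _) ⟩
        invFactMN * ∑ L (λ i → (invFact i * invFact (L ∸ i)) * (pow (r * s) i * binomSum (L ∸ i) (Inner W)))
          ≈⟨ *-congˡ (sym (invFact-binomSum L _)) ⟩
        invFactMN * (invFact L * Outer L W) ∎
        where
        regroup : ∀ (p f m g X : Carrier) → (p * f) * (m * (g * X)) ≈ m * ((f * g) * (p * X))
        regroup = solve 5 (λ p f m g X → (p :* f) :* (m :* (g :* X)) := m :* ((f :* g) :* (p :* X))) refl
        x-term : ∀ i →
          ∑ M (λ j → ∑ N (λ k → expPS (lin (r * s) r s) i j k * rhsSum a b r s (L ∸ i) (M ∸ j) (N ∸ k)))
            ≈ expTerm (r * s) i * (invFactMN * (invFact (L ∸ i) * binomSum (L ∸ i) (Inner W)))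
        x-term i =
          trans (∑-cong M (λ j → trans (∑-cong N (λ k →
                    trans (*-cong (exp-coeff i j k) (rhsSum-coeff (L ∸ i) (M ∸ j) (N ∸ k))) (*-assoc _ _ _)))
                  (sym (∑-*ˡ N _ _))))
                (trans (sym (∑-*ˡ M _ _)) (*-congˡ (l-sum (L ∸ i))))


mainTheorem3 : {c ℓ : Level} (R : CommutativeRing c ℓ) →
    let open CommutativeRing R
        open Series R
    in (inv : ℕ → Carrier) → (∀ k → cast (suc k) * inv k ≈ 1#) →
       let open WithInverses inv
       in ∀ (a b r s : Carrier) (l m n : ℕ) →
          LHS a b r s l m n ≈ RHS a b r s l m n
mainTheorem3 R inv inv-correct a b r s L M N = begin
  LHS a b r s L M N
    ≈⟨ *-congʳ (Cpoly-product a b L M N) ⟩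
  Outer L W * (invFact L * invFact M * invFact N)
    ≈⟨ regroup _ _ _ _ ⟩
  (invFact M * invFact N) * (invFact L * Outer L W)
    ≈⟨ sym (RHS-coeff L) ⟩
  RHS a b r s L M N ∎
  where
  open CommutativeRing R
  open Series R
  open WithInverses inv
  open RingFacts R using (module Expansion)
  open Expansion r s using (Cpoly-product; Outer)
  open InverseFacts R inv inv-correct using (module RightHandSide)
  open RightHandSide.Collapse a b r s M N using (W; RHS-coeff)
  open import Relation.Binary.Reasoning.Setoid setoid
  open import Algebra.Solver.Ring.NaturalCoefficients commutativeSemiring (λ _ _ → nothing)
    using (solve; _:=_; _:*_)
  regroup : ∀ (O x y z : Carrier) → O * (x * y * z) ≈ (y * z) * (x * O)
  regroup = solve 4 (λ O x y z → O :* (x :* y :* z) := (y :* z) :* (x :* O)) refl
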